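{- Suppose the language $\mathcal{L}$ contains, for all outcomes $\alpha,\beta$, statements $\alpha\ge\beta$ and $\alpha>\beta$ with $\pi\models\alpha\ge\beta$ iff $\alpha\succcurlyeq_\pi\beta$, and $\pi\models\alpha>\beta$ iff $\alpha\succ_\pi\beta$. Then for any outcomes $\alpha,\beta$, the statements $\alpha\ge\beta$ and $\alpha>\beta$ are strongly compositional, and for every lex model $\pi$, $\pi\models^*\alpha\ge\beta$ iff $\pi\models\alpha\ge\beta$; also, if $\alpha\neq\beta$, then $\pi\models^*\alpha>\beta$ iff $\pi\models\alpha\ge\beta$. In addition, for any $\mathfrak{R}\subseteq\underline{V}\times\underline{V}$, any statement $\varphi^{\mathfrak{R}}$ satisfying ($\pi\models\varphi^{\mathfrak{R}}$ iff $\succcurlyeq_\pi\supseteq\mathfrak{R}$) for all lex models $\pi$ is strongly compositional, and for every lex model $\pi$, $\pi\models^*\varphi^{\mathfrak{R}}$ iff $\pi\models\varphi^{\mathfrak{R}}$.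
   Context: Let $V$ be a finite set of variables with finite nonempty domains $\underline{X}$; outcomes are elements of $\underline{V}$ (full assignments); $\alpha(U)$ is the restriction of $\alpha$ to $U\subseteq V$. A lex model $\pi$ is a (possibly empty) sequence $(Y_1,\ge_{Y_1}),\ldots,(Y_k,\ge_{Y_k})$ of pairwise distinct variables each with a total order on its domain; $V_\pi=\{Y_1,\ldots,Y_k\}$; $\mathcal{G}$ is the set of lex models. $\alpha\succ_\pi\beta$ iff for some $i$, $\alpha(Y_j)=\beta(Y_j)$ for all $j<i$ and $\alpha(Y_i)>_{Y_i}\beta(Y_i)$ strictly; $\alpha\equiv_\pi\beta$ iff $\alpha(V_\pi)=\beta(V_\pi)$; $\alpha\succcurlyeq_\pi\beta$ iff $\alpha\succ_\pi\beta$ or $\alpha\equiv_\pi\beta$; $\succcurlyeq_\pi$ is viewed as a subset of $\underline{V}\times\underline{V}$. For $\pi'=(Z_1,\ge_{Z_1}),\ldots$, $\pi\circ\pi'$ is $\pi$ followed by $\pi'$ with pairs whose variable is in $V_\pi$ deleted. $\pi'$ extends $\pi$ if $\pi'\ne\pi$ and $\pi'$ begins with $\pi$; $\pi'\sqsupseteq\pi$ means extends or equals. $\mathcal{L}$ is a set of statements with a satisfaction relation $\models\ \subseteq\mathcal{G}\times\mathcal{L}$. $\pi\models^*\varphi$ iff some $\pi'\sqsupseteq\pi$ has $\pi'\models\varphi$. $\varphi$ is strongly compositional if for all $\pi,\pi'\in\mathcal{G}$, $\pi\models^*\varphi$ and $\pi'\models\varphi$ imply $\pi\circ\pi'\models\varphi$.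 -}

module Defs where

open import Level using (Level; _⊔_; suc; 0ℓ)
open import Data.Nat using (ℕ)
open import Data.Fin using (Fin)
open import Data.Fin.Properties using (_≟_)
open import Data.List using (List; []; _∷_; _++_; map)
open import Data.List.Membership.Propositional using (_∈_; _∉_)
open import Data.List.Relation.Unary.Any using (here; there)
open import Data.List.Relation.Unary.All using (All; []; _∷_)
open import Data.List.Relation.Unary.AllPairs using ([]; _∷_)
open import Data.List.Relation.Unary.Unique.Propositional using (Unique)
open import Data.List.Relation.Unary.Unique.Propositional.Properties using (++⁺)
open import Data.Product using (Σ; ∃; _×_; _,_; proj₁; proj₂)
open import Data.Sum using (_⊎_)
open import Data.Empty using (⊥)
open import Relation.Binary using (Rel; IsTotalOrder)
open import Relation.Binary.PropositionalEquality using (_≡_; _≢_; refl)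
open import Relation.Nullary using (¬_; yes; no)
open import Function.Bundles using (_⇔_)

-- Variables V = Fin n; the domain of variable i is Fin (d i).
module LexDefs {n : ℕ} (d : Fin n → ℕ) where

  open import Data.List.Membership.DecPropositional (_≟_ {n}) using (_∈?_)

  Outcome : Set
  Outcome = (i : Fin n) → Fin (d i)

  _≐_ : Outcome → Outcome → Set
  α ≐ β = ∀ i → α i ≡ β i

  -- a pair (Y, ≥_Y): a variable with a total order on its domain.
  -- ge a b means a ≥_Y b.
  record Entry : Set₁ where
    constructor entry
    field
      var : Fin n
      ge : Rel (Fin (d var)) 0ℓ
      isTotalOrder : IsTotalOrder _≡_ ge

  open Entry public

  vars : List Entry → List (Fin n)
  vars = map var

  record LexModel : Set₁ where
    constructor lexModel
    field
      seq : List Entry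
      distinct : Unique (vars seq)

  open LexModel public

  Vπ : LexModel → List (Fin n)
  Vπ π = vars (seq π)

  _>[_]_ : {Y : Fin n} → Fin (d Y) → Rel (Fin (d Y)) 0ℓ → Fin (d Y) → Set
  a >[ R ] b = R a b × a ≢ b

  _≻ˢ[_]_ : Outcome → List Entry → Outcome → Set
  α ≻ˢ[ [] ] β = ⊥
  α ≻ˢ[ e ∷ es ] β =
    (α (var e) >[ ge e ] β (var e)) ⊎ (α (var e) ≡ β (var e) × α ≻ˢ[ es ] β)

  _≻[_]_ : Outcome → LexModel → Outcome → Set
  α ≻[ π ] β = α ≻ˢ[ seq π ] β

  _≡[_]_ : Outcome → LexModel → Outcome → Set
  α ≡[ π ] β = All (λ Y → α Y ≡ β Y) (Vπ π)

  _≽[_]_ : Outcome → LexModel → Outcome → Set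
  α ≽[ π ] β = (α ≻[ π ] β) ⊎ (α ≡[ π ] β)

  _⊑_ : LexModel → LexModel → Set₁
  π ⊑ π' = ∃ λ (rest : List Entry) → seq π' ≡ seq π ++ rest

  remove : List (Fin n) → List Entry → List Entry
  remove xs [] = []
  remove xs (e ∷ es) with var e ∈? xs
  ... | yes _ = remove xs es
  ... | no _ = e ∷ remove xs es

  remove-sub : ∀ xs es {y} → y ∈ vars (remove xs es) → y ∈ vars es
  remove-sub xs [] ()
  remove-sub xs (e ∷ es) p with var e ∈? xs
  ... | yes _ = there (remove-sub xs es p)
  remove-sub xs (e ∷ es) (here q) | no _ = here q
  remove-sub xs (e ∷ es) (there p) | no _ = there (remove-sub xs es p)

  remove-notin : ∀ xs es {y} → y ∈ vars (remove xs es) → y ∉ xs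
  remove-notin xs [] ()
  remove-notin xs (e ∷ es) p with var e ∈? xs
  ... | yes _ = remove-notin xs es p
  remove-notin xs (e ∷ es) (here refl) | no ¬q = ¬q
  remove-notin xs (e ∷ es) (there p) | no _ = remove-notin xs es p

  private
    all-sub : ∀ {x} (ys zs : List (Fin n)) → (∀ {y} → y ∈ ys → y ∈ zs) →
              All (x ≢_) zs → All (x ≢_) ys
    all-sub [] zs s a = []
    all-sub (y ∷ ys) zs s a =
      lookupAll a (s (here refl)) ∷ all-sub ys zs (λ p → s (there p)) a
      where
      lookupAll : ∀ {x w} {ws : List (Fin n)} → All (x ≢_) ws → w ∈ ws → x ≢ w
      lookupAll (px ∷ _) (here refl) = px
      lookupAll (_ ∷ pxs) (there q) = lookupAll pxs q

  remove-unique : ∀ xs es → Unique (vars es) → Unique (vars (remove xs es))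
  remove-unique xs [] u = []
  remove-unique xs (e ∷ es) (a ∷ u) with var e ∈? xs
  ... | yes _ = remove-unique xs es u
  ... | no _ = all-sub (vars (remove xs es)) (vars es) (remove-sub xs es) a
               ∷ remove-unique xs es u

  _∘ˡ_ : LexModel → LexModel → LexModel
  π ∘ˡ π' = lexModel (seq π ++ remove (Vπ π) (seq π'))
    (subst-unique (++⁺ (distinct π) (remove-unique (Vπ π) (seq π') (distinct π'))
                       (λ { (p , q) → remove-notin (Vπ π) (seq π') q p })))
    where
    map-++ : ∀ (as bs : List Entry) → vars (as ++ bs) ≡ vars as ++ vars bs
    map-++ [] bs = refl
    map-++ (a ∷ as) bs rewrite map-++ as bs = refl
    subst-unique : Unique (Vπ π ++ vars (remove (Vπ π) (seq π'))) →
                   Unique (vars (seq π ++ remove (Vπ π) (seq π')))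
    subst-unique u rewrite map-++ (seq π) (remove (Vπ π) (seq π')) = u

  module Sat {ℓ₁ ℓ₂ : Level} {L : Set ℓ₁} (_⊨_ : LexModel → L → Set ℓ₂) where

    _⊨*_ : LexModel → L → Set (suc 0ℓ ⊔ ℓ₂)
    π ⊨* φ = ∃ λ π' → π ⊑ π' × π' ⊨ φ

    StronglyCompositional : L → Set (suc 0ℓ ⊔ ℓ₂)
    StronglyCompositional φ = ∀ π π' → π ⊨* φ → π' ⊨ φ → (π ∘ˡ π') ⊨ φ

{-# OPTIONS --safe #-}
module Submission where

-- Everything reduces to two closure properties of lex orders.  Cutting a lex
-- model down to a prefix can only turn a strict preference into a tie, so both
-- α ≽ β and α ≻ β give α ≽ β on every prefix; hence ⊨* collapses to ⊨ for ≽ and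
-- for "≽ contains R".  In π ∘ π' the deleted entries of π' carry variables of π,
-- on which α and β agree unless π already decides between them; so π ∘ π'
-- decides as π does, or else as π' does.  Finally, if α ≠ β, a variable where
-- they differ, ordered with α's value on top, extends any π that ties them to
-- a model preferring α strictly.

open import Defs
open import Level using (Level; 0ℓ)
open import Data.Nat using (ℕ; _<_)
open import Data.Fin using (Fin)
import Data.Fin as Fin
open import Data.Fin.Properties using (_≟_; ≤-total; ≤-isTotalOrder; ¬∀⟶∃¬)
open import Data.Product using (_×_; Σ; ∃; _,_)
open import Data.Sum using (_⊎_; inj₁; inj₂)
open import Data.Empty using (⊥-elim)
open import Data.List using (List; []; _∷_; _++_)
open import Data.List.Properties using (++-identityʳ; map-++)
open import Data.List.Relation.Unary.All as All using (All; []; _∷_)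
open import Data.List.Relation.Unary.All.Properties using (++⁺; ++⁻ˡ)
open import Data.List.Relation.Unary.AllPairs using ([]; _∷_)
open import Relation.Binary using (Rel; IsTotalOrder)
open import Relation.Binary.PropositionalEquality using (_≡_; refl; sym; subst)
import Relation.Binary.Construct.Flip.EqAndOrd as Flip
open import Relation.Nullary using (¬_; yes; no)
open import Function using (flip)
open import Function.Bundles using (_⇔_; mk⇔; Equivalence)

totalOrder-relating : ∀ {m} (a b : Fin m) →
                      Σ (Rel (Fin m) 0ℓ) λ R → IsTotalOrder _≡_ R × R a b
totalOrder-relating a b with ≤-total a b
... | inj₁ a≤b = Fin._≤_ , ≤-isTotalOrder , a≤b
... | inj₂ b≤a = flip Fin._≤_ , Flip.isTotalOrder ≤-isTotalOrder , b≤a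

module LexOrder {n : ℕ} (d : Fin n → ℕ) where
  open LexDefs d
  open import Data.List.Membership.DecPropositional (_≟_ {n}) using (_∈?_)

  _≡ˢ[_]_ : Outcome → List Entry → Outcome → Set
  α ≡ˢ[ es ] β = All (λ Y → α Y ≡ β Y) (vars es)

  _≽ˢ[_]_ : Outcome → List Entry → Outcome → Set
  α ≽ˢ[ es ] β = α ≻ˢ[ es ] β ⊎ α ≡ˢ[ es ] β

  ⊑-refl : ∀ π → π ⊑ π
  ⊑-refl π = [] , sym (++-identityʳ (seq π))

  ⊑-∘ˡ : ∀ π π' → π ⊑ (π ∘ˡ π')
  ⊑-∘ˡ π π' = remove (Vπ π) (seq π') , refl

  module _ {α β : Outcome} where

    ≡ˢ-++⁺ : ∀ xs {ys} → α ≡ˢ[ xs ] β → α ≡ˢ[ ys ] β → α ≡ˢ[ xs ++ ys ] β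
    ≡ˢ-++⁺ xs {ys} p q = subst (All _) (sym (map-++ var xs ys)) (++⁺ p q)

    ≡ˢ-++⁻ˡ : ∀ xs {ys} → α ≡ˢ[ xs ++ ys ] β → α ≡ˢ[ xs ] β
    ≡ˢ-++⁻ˡ xs {ys} p = ++⁻ˡ (vars xs) (subst (All _) (map-++ var xs ys) p)

    ≻ˢ-++⁺ˡ : ∀ xs {ys} → α ≻ˢ[ xs ] β → α ≻ˢ[ xs ++ ys ] β
    ≻ˢ-++⁺ˡ (x ∷ xs) (inj₁ gt)       = inj₁ gt
    ≻ˢ-++⁺ˡ (x ∷ xs) (inj₂ (eq , p)) = inj₂ (eq , ≻ˢ-++⁺ˡ xs p)

    ≻ˢ-++⁺ʳ : ∀ xs {ys} → α ≡ˢ[ xs ] β → α ≻ˢ[ ys ] β → α ≻ˢ[ xs ++ ys ] β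
    ≻ˢ-++⁺ʳ []       []       p = p
    ≻ˢ-++⁺ʳ (x ∷ xs) (eq ∷ q) p = inj₂ (eq , ≻ˢ-++⁺ʳ xs q p)

    ≽ˢ-++⁺ʳ : ∀ xs {ys} → α ≡ˢ[ xs ] β → α ≽ˢ[ ys ] β → α ≽ˢ[ xs ++ ys ] β
    ≽ˢ-++⁺ʳ xs q (inj₁ p) = inj₁ (≻ˢ-++⁺ʳ xs q p)
    ≽ˢ-++⁺ʳ xs q (inj₂ p) = inj₂ (≡ˢ-++⁺ xs q p)

    ≻ˢ-++⁻ˡ : ∀ xs {ys} → α ≻ˢ[ xs ++ ys ] β → α ≽ˢ[ xs ] β
    ≻ˢ-++⁻ˡ []       p               = inj₂ []
    ≻ˢ-++⁻ˡ (x ∷ xs) (inj₁ gt)       = inj₁ (inj₁ gt)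
    ≻ˢ-++⁻ˡ (x ∷ xs) (inj₂ (eq , p)) with ≻ˢ-++⁻ˡ xs p
    ... | inj₁ q = inj₁ (inj₂ (eq , q))
    ... | inj₂ q = inj₂ (eq ∷ q)

    ≽ˢ-++⁻ˡ : ∀ xs {ys} → α ≽ˢ[ xs ++ ys ] β → α ≽ˢ[ xs ] β
    ≽ˢ-++⁻ˡ xs (inj₁ p) = ≻ˢ-++⁻ˡ xs p
    ≽ˢ-++⁻ˡ xs (inj₂ p) = inj₂ (≡ˢ-++⁻ˡ xs p)

    ≻ˢ-remove : ∀ zs es → All (λ Y → α Y ≡ β Y) zs →
                α ≻ˢ[ es ] β → α ≻ˢ[ remove zs es ] β
    ≻ˢ-remove zs (e ∷ es) agree p with var e ∈? zs | p
    ... | yes e∈zs | inj₁ (_ , αe≢βe) = ⊥-elim (αe≢βe (All.lookup agree e∈zs))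
    ... | yes _    | inj₂ (_ , q)     = ≻ˢ-remove zs es agree q
    ... | no _     | inj₁ gt          = inj₁ gt
    ... | no _     | inj₂ (eq , q)    = inj₂ (eq , ≻ˢ-remove zs es agree q)

    ≡ˢ-remove : ∀ zs es → α ≡ˢ[ es ] β → α ≡ˢ[ remove zs es ] β
    ≡ˢ-remove zs es p = All.tabulate λ y∈ → All.lookup p (remove-sub zs es y∈)

    ≽ˢ-remove : ∀ zs es → All (λ Y → α Y ≡ β Y) zs →
                α ≽ˢ[ es ] β → α ≽ˢ[ remove zs es ] β
    ≽ˢ-remove zs es agree (inj₁ p) = inj₁ (≻ˢ-remove zs es agree p)
    ≽ˢ-remove zs es agree (inj₂ p) = inj₂ (≡ˢ-remove zs es p)

    ≻-prefix : ∀ π π' → π ⊑ π' → α ≻[ π' ] β → α ≽[ π ] β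
    ≻-prefix π π' (_ , refl) = ≻ˢ-++⁻ˡ (seq π)

    ≽-prefix : ∀ π π' → π ⊑ π' → α ≽[ π' ] β → α ≽[ π ] β
    ≽-prefix π π' (_ , refl) = ≽ˢ-++⁻ˡ (seq π)

    ≻-∘ˡ : ∀ π π' → α ≽[ π ] β → α ≻[ π' ] β → α ≻[ π ∘ˡ π' ] β
    ≻-∘ˡ π π' (inj₁ p) _ = ≻ˢ-++⁺ˡ (seq π) p
    ≻-∘ˡ π π' (inj₂ q) p = ≻ˢ-++⁺ʳ (seq π) q (≻ˢ-remove (Vπ π) (seq π') q p)

    ≽-∘ˡ : ∀ π π' → α ≽[ π ] β → α ≽[ π' ] β → α ≽[ π ∘ˡ π' ] β
    ≽-∘ˡ π π' (inj₁ p) _ = inj₁ (≻ˢ-++⁺ˡ (seq π) p)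
    ≽-∘ˡ π π' (inj₂ q) p = ≽ˢ-++⁺ʳ (seq π) q (≽ˢ-remove (Vπ π) (seq π') q p)

    ≢⇒∃≻ : ¬ (α ≐ β) → ∃ λ π → α ≻[ π ] β
    ≢⇒∃≻ α≠β with ¬∀⟶∃¬ n (λ i → α i ≡ β i) (λ i → α i ≟ β i) α≠β
    ... | i , αi≢βi with totalOrder-relating (α i) (β i)
    ... | R , isTotal , αi≥βi =
      lexModel (entry i R isTotal ∷ []) ([] ∷ []) , inj₁ (αi≥βi , αi≢βi)

    ≽⇒∃⊒≻ : ¬ (α ≐ β) → ∀ π → α ≽[ π ] β → ∃ λ π' → π ⊑ π' × α ≻[ π' ] β
    ≽⇒∃⊒≻ α≠β π (inj₁ p) = π , ⊑-refl π , p
    ≽⇒∃⊒≻ α≠β π (inj₂ q) with ≢⇒∃≻ α≠β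
    ... | π' , p = π ∘ˡ π' , ⊑-∘ˡ π π' , ≻-∘ˡ π π' (inj₂ q) p

  ≽[_]⊇_ : ∀ {ℓ} → LexModel → (Outcome → Outcome → Set ℓ) → Set ℓ
  ≽[ π ]⊇ R = ∀ α β → R α β → α ≽[ π ] β

  ⊇-prefix : ∀ {ℓ} {R : Outcome → Outcome → Set ℓ} (π π' : LexModel) →
             π ⊑ π' → ≽[ π' ]⊇ R → ≽[ π ]⊇ R
  ⊇-prefix π π' π⊑π' π'⊇R α β r = ≽-prefix π π' π⊑π' (π'⊇R α β r)

  ⊇-∘ˡ : ∀ {ℓ} {R : Outcome → Outcome → Set ℓ} π π' →
         ≽[ π ]⊇ R → ≽[ π' ]⊇ R → ≽[ π ∘ˡ π' ]⊇ R
  ⊇-∘ˡ π π' π⊇R π'⊇R α β r = ≽-∘ˡ π π' (π⊇R α β r) (π'⊇R α β r)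

module Compositionality {n : ℕ} (d : Fin n → ℕ) {ℓ₁ ℓ₂ : Level} {L : Set ℓ₁}
                        (_⊨_ : LexDefs.LexModel d → L → Set ℓ₂) where
  open LexDefs d
  open LexOrder d
  open Sat _⊨_

  module _ {p : Level} {φ : L} (P : LexModel → Set p) (⊨⇔P : ∀ π → (π ⊨ φ) ⇔ P π) where
    open module ⊨⇔P π = Equivalence (⊨⇔P π) using (to; from)

    ⊨*⇒ : ∀ {q} (Q : LexModel → Set q) → (∀ π π' → π ⊑ π' → P π' → Q π) →
          ∀ π → π ⊨* φ → Q π
    ⊨*⇒ Q prefix π (π' , π⊑π' , π'⊨φ) = prefix π π' π⊑π' (to π' π'⊨φ)

    ⊨*⇔⊨ : (∀ π π' → π ⊑ π' → P π' → P π) → ∀ π → (π ⊨* φ) ⇔ (π ⊨ φ)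
    ⊨*⇔⊨ prefix π = mk⇔ (λ π⊨*φ → from π (⊨*⇒ P prefix π π⊨*φ))
                        (λ π⊨φ → π , ⊑-refl π , π⊨φ)

    stronglyCompositional : ∀ {q} (Q : LexModel → Set q) →
                            (∀ π π' → π ⊑ π' → P π' → Q π) →
                            (∀ π π' → Q π → P π' → P (π ∘ˡ π')) →
                            StronglyCompositional φ
    stronglyCompositional Q prefix compose π π' π⊨*φ π'⊨φ =
      from (π ∘ˡ π') (compose π π' (⊨*⇒ Q prefix π π⊨*φ) (to π' π'⊨φ))

  module _ {α β : Outcome} {geq : L} (⊨geq : ∀ π → (π ⊨ geq) ⇔ (α ≽[ π ] β)) where

    private
      α≽β α≻β : LexModel → Set
      α≽β π = α ≽[ π ] β
      α≻β π = α ≻[ π ] β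

    ≽-stronglyCompositional : StronglyCompositional geq
    ≽-stronglyCompositional = stronglyCompositional α≽β ⊨geq α≽β (≽-prefix {α} {β}) ≽-∘ˡ

    ⊨*≽⇔⊨≽ : ∀ π → (π ⊨* geq) ⇔ (π ⊨ geq)
    ⊨*≽⇔⊨≽ = ⊨*⇔⊨ α≽β ⊨geq (≽-prefix {α} {β})

    module _ {gt : L} (⊨gt : ∀ π → (π ⊨ gt) ⇔ (α ≻[ π ] β)) where

      ≻-stronglyCompositional : StronglyCompositional gt
      ≻-stronglyCompositional = stronglyCompositional α≻β ⊨gt α≽β (≻-prefix {α} {β}) ≻-∘ˡ

      ⊨*≻⇔⊨≽ : ¬ (α ≐ β) → ∀ π → (π ⊨* gt) ⇔ (π ⊨ geq)
      ⊨*≻⇔⊨≽ α≠β π = mk⇔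
        (λ π⊨*gt → Equivalence.from (⊨geq π) (⊨*⇒ α≻β ⊨gt α≽β (≻-prefix {α} {β}) π π⊨*gt))
        (λ π⊨geq → let π' , π⊑π' , p = ≽⇒∃⊒≻ α≠β π (Equivalence.to (⊨geq π) π⊨geq)
                   in π' , π⊑π' , Equivalence.from (⊨gt π') p)

  module _ {ℓ} {R : Outcome → Outcome → Set ℓ} {φ : L} (⊨φ : ∀ π → (π ⊨ φ) ⇔ ≽[ π ]⊇ R) where

    private
      ≽⊇R : LexModel → Set ℓ
      ≽⊇R π = ≽[ π ]⊇ R

    ⊇-stronglyCompositional : StronglyCompositional φ
    ⊇-stronglyCompositional = stronglyCompositional ≽⊇R ⊨φ ≽⊇R ⊇-prefix ⊇-∘ˡ

    ⊨*⊇⇔⊨⊇ : ∀ π → (π ⊨* φ) ⇔ (π ⊨ φ)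
    ⊨*⊇⇔⊨⊇ = ⊨*⇔⊨ ≽⊇R ⊨φ ⊇-prefix

proposition1 : ∀ {ℓ₁ ℓ₂ ℓ₃ : Level} (n : ℕ) (d : Fin n → ℕ) → (∀ i → 0 < d i) →
    let open LexDefs d in
    (L : Set ℓ₁) (_⊨_ : LexModel → L → Set ℓ₂) →
    let open Sat _⊨_ in
    ((geq gt : Outcome → Outcome → L) →
      (∀ π α β → (π ⊨ geq α β) ⇔ (α ≽[ π ] β)) →
      (∀ π α β → (π ⊨ gt α β) ⇔ (α ≻[ π ] β)) →
      ∀ α β →
        StronglyCompositional (geq α β)
        × StronglyCompositional (gt α β)
        × (∀ π → (π ⊨* geq α β) ⇔ (π ⊨ geq α β))
        × (¬ (α ≐ β) → ∀ π → (π ⊨* gt α β) ⇔ (π ⊨ geq α β)))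
    × ((R : Outcome → Outcome → Set ℓ₃) (φ : L) →
      (∀ π → (π ⊨ φ) ⇔ (∀ α β → R α β → α ≽[ π ] β)) →
        StronglyCompositional φ
        × (∀ π → (π ⊨* φ) ⇔ (π ⊨ φ)))
proposition1 n d _ L _⊨_ =
    (λ geq gt ⊨geq ⊨gt α β →
      let ⊨geq[αβ] = λ π → ⊨geq π α β; ⊨gt[αβ] = λ π → ⊨gt π α β in
        ≽-stronglyCompositional ⊨geq[αβ]
      , ≻-stronglyCompositional ⊨geq[αβ] ⊨gt[αβ]
      , ⊨*≽⇔⊨≽ ⊨geq[αβ]
      , ⊨*≻⇔⊨≽ ⊨geq[αβ] ⊨gt[αβ])
  , (λ R φ ⊨φ → ⊇-stronglyCompositional ⊨φ , ⊨*⊇⇔⊨⊇ ⊨φ)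
  where open Compositionality d _⊨_
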